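{- Let $p_0,p_1,p_2$ be positive integers with $\gcd(p_0,p_1,p_2)=1$, and put $n=p_0+p_1+p_2$. Let $E=(\mathbb{Z}/n\mathbb{Z})\times\{0,1,2\}$, and let $\sigma_0,\sigma_1$ be the permutations of $E$ defined for $m\in\mathbb{Z}/n\mathbb{Z}$ by $$\sigma_0(m,0)=(m,1),\quad \sigma_0(m,1)=(m,2),\quad \sigma_0(m,2)=(m,0),$$ $$\sigma_1(m,0)=(m-p_1,2),\quad \sigma_1(m,1)=(m-p_2,0),\quad \sigma_1(m,2)=(m-p_0,1).$$ Let $G=\langle\sigma_0,\sigma_1\rangle$, $N=\langle\sigma_0\sigma_1,\sigma_1\sigma_0\rangle$ and $H=\langle\sigma_0\rangle$. Then $NH=G$.
   Context: Composition of permutations is as functions: $(\sigma\tau)(x)=\sigma(\tau(x))$. $NH=\{xy: x\in N, y\in H\}$. -}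

module Defs where

open import Data.Nat using (ℕ; zero; suc; _+_; _*_; _∸_)
open import Data.Nat.Properties using (+-assoc; m∸n+n≡m; m≤m*n; +-comm)
import Data.Nat.DivMod
open import Data.Nat.DivMod using (_%_; _mod_; [m+kn]%n≡m%n; %-distribˡ-+; m%n%n≡m%n; m<n⇒m%n≡m)
open import Data.Fin using (Fin; toℕ; fromℕ<)
import Data.Fin as Fin
open import Data.Fin.Properties using (toℕ-fromℕ<; toℕ-injective; toℕ<n)
open import Data.Product using (_×_; _,_; Σ; ∃-syntax)
open import Relation.Binary.PropositionalEquality using (_≡_; refl; sym; trans; cong; module ≡-Reasoning)
open ≡-Reasoning

-- Z/nZ represented by Fin n (n ≥ 1 is forced by having an element)

_⊕_ : ∀ {n} → Fin n → ℕ → Fin n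
_⊕_ {suc k} m p = (toℕ m + p) mod (suc k)

-- m - p  (mod n), computed as m + (n·p − p), since n·p − p ≡ −p (mod n)
_⊖_ : ∀ {n} → Fin n → ℕ → Fin n
_⊖_ {n} m p = m ⊕ (n * p ∸ p)

private
  ⊕⊕ : ∀ {k} (m : Fin (suc k)) x y → toℕ ((m ⊕ x) ⊕ y) ≡ (toℕ m + x + y) % suc k
  ⊕⊕ {k} m x y = begin
      toℕ ((toℕ (m ⊕ x) + y) mod suc k)
    ≡⟨ toℕ-fromℕ< _ ⟩
      (toℕ (m ⊕ x) + y) % suc k
    ≡⟨ cong (λ z → (z + y) % suc k) (toℕ-fromℕ< (Data.Nat.DivMod.m%n<n (toℕ m + x) (suc k))) ⟩
      ((toℕ m + x) % suc k + y) % suc k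
    ≡⟨ %-distribˡ-+ ((toℕ m + x) % suc k) y (suc k) ⟩
      ((toℕ m + x) % suc k % suc k + y % suc k) % suc k
    ≡⟨ cong (λ z → (z + y % suc k) % suc k) (m%n%n≡m%n (toℕ m + x) (suc k)) ⟩
      ((toℕ m + x) % suc k + y % suc k) % suc k
    ≡⟨ sym (%-distribˡ-+ (toℕ m + x) y (suc k)) ⟩
      (toℕ m + x + y) % suc k ∎

  cancel : ∀ {n} (m : Fin n) x y c → x + y ≡ c * n → (m ⊕ x) ⊕ y ≡ m
  cancel {suc k} m x y c eq = toℕ-injective (begin
      toℕ ((m ⊕ x) ⊕ y)
    ≡⟨ ⊕⊕ m x y ⟩
      (toℕ m + x + y) % suc k
    ≡⟨ cong (_% suc k) (trans (+-assoc (toℕ m) x y) (cong (toℕ m +_) eq)) ⟩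
      (toℕ m + c * suc k) % suc k
    ≡⟨ [m+kn]%n≡m%n (toℕ m) c (suc k) ⟩
      toℕ m % suc k
    ≡⟨ m<n⇒m%n≡m (toℕ<n m) ⟩
      toℕ m ∎)

  np : ∀ k p → (suc k * p ∸ p) + p ≡ p * suc k
  np k p = trans (m∸n+n≡m {suc k * p} {p} (Data.Nat.Properties.m≤n*m p (suc k)))
                       (Data.Nat.Properties.*-comm (suc k) p)
    where import Data.Nat.Properties

⊖⊕ : ∀ {n} (m : Fin n) p → (m ⊖ p) ⊕ p ≡ m
⊖⊕ {suc k} m p = cancel m (suc k * p ∸ p) p p (np k p)

⊕⊖ : ∀ {n} (m : Fin n) p → (m ⊕ p) ⊖ p ≡ m
⊕⊖ {suc k} m p = cancel m p (suc k * p ∸ p) p (trans (+-comm p (suc k * p ∸ p)) (np k p))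

E : ℕ → Set
E n = Fin n × Fin 3

pattern 0₃ = Fin.zero
pattern 1₃ = Fin.suc Fin.zero
pattern 2₃ = Fin.suc (Fin.suc Fin.zero)

record Perm (n : ℕ) : Set where
  field
    to      : E n → E n
    from    : E n → E n
    to-from : ∀ x → to (from x) ≡ x
    from-to : ∀ x → from (to x) ≡ x
open Perm public

_≈_ : ∀ {n} → Perm n → Perm n → Set
σ ≈ τ = ∀ x → to σ x ≡ to τ x

idP : ∀ {n} → Perm n
idP = record { to = λ x → x ; from = λ x → x ; to-from = λ _ → refl ; from-to = λ _ → refl }

_∘ₚ_ : ∀ {n} → Perm n → Perm n → Perm n
σ ∘ₚ τ = record
  { to      = λ x → to σ (to τ x)
  ; from    = λ x → from τ (from σ x)
  ; to-from = λ x → trans (cong (to σ) (to-from τ (from σ x))) (to-from σ x)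
  ; from-to = λ x → trans (cong (from τ) (from-to σ (to τ x))) (from-to τ x)
  }

_⁻¹ₚ : ∀ {n} → Perm n → Perm n
σ ⁻¹ₚ = record { to = from σ ; from = to σ ; to-from = from-to σ ; from-to = to-from σ }

data ⟨_⟩ {n : ℕ} {I : Set} (g : I → Perm n) : Perm n → Set where
  gen  : ∀ i → ⟨ g ⟩ (g i)
  one  : ⟨ g ⟩ idP
  inv  : ∀ {σ} → ⟨ g ⟩ σ → ⟨ g ⟩ (σ ⁻¹ₚ)
  mul  : ∀ {σ τ} → ⟨ g ⟩ σ → ⟨ g ⟩ τ → ⟨ g ⟩ (σ ∘ₚ τ)
  ext  : ∀ {σ τ} → σ ≈ τ → ⟨ g ⟩ σ → ⟨ g ⟩ τ

[_] : ∀ {n} → Perm n → Fin 1 → Perm n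
[ a ] _ = a

[_,_] : ∀ {n} → Perm n → Perm n → Fin 2 → Perm n
[ a , b ] Fin.zero = a
[ a , b ] (Fin.suc _) = b

_·_ : ∀ {n} → (Perm n → Set) → (Perm n → Set) → Perm n → Set
(N · H) σ = Σ _ λ x → Σ _ λ y → N x × H y × (x ∘ₚ y) ≈ σ

_≐_ : ∀ {n} → (Perm n → Set) → (Perm n → Set) → Set
A ≐ B = (∀ σ → A σ → B σ) × (∀ σ → B σ → A σ)

σ₀ : ∀ {n} → Perm n
σ₀ {n} = record { to = f ; from = g ; to-from = fg ; from-to = gf }
  where
  f g : E n → E n
  f (m , 0₃) = m , 1₃
  f (m , 1₃) = m , 2₃
  f (m , 2₃) = m , 0₃
  g (m , 0₃) = m , 2₃
  g (m , 1₃) = m , 0₃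
  g (m , 2₃) = m , 1₃
  fg : ∀ x → f (g x) ≡ x
  fg (m , 0₃) = refl
  fg (m , 1₃) = refl
  fg (m , 2₃) = refl
  gf : ∀ x → g (f x) ≡ x
  gf (m , 0₃) = refl
  gf (m , 1₃) = refl
  gf (m , 2₃) = refl

σ₁ : ∀ {n} (p₀ p₁ p₂ : ℕ) → Perm n
σ₁ {n} p₀ p₁ p₂ = record { to = f ; from = g ; to-from = fg ; from-to = gf }
  where
  f g : E n → E n
  f (m , 0₃) = m ⊖ p₁ , 2₃
  f (m , 1₃) = m ⊖ p₂ , 0₃
  f (m , 2₃) = m ⊖ p₀ , 1₃
  g (m , 2₃) = m ⊕ p₁ , 0₃
  g (m , 0₃) = m ⊕ p₂ , 1₃
  g (m , 1₃) = m ⊕ p₀ , 2₃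
  fg : ∀ x → f (g x) ≡ x
  fg (m , 0₃) = cong (_, 0₃) (⊕⊖ m p₂)
  fg (m , 1₃) = cong (_, 1₃) (⊕⊖ m p₀)
  fg (m , 2₃) = cong (_, 2₃) (⊕⊖ m p₁)
  gf : ∀ x → g (f x) ≡ x
  gf (m , 0₃) = cong (_, 0₃) (⊖⊕ m p₁)
  gf (m , 1₃) = cong (_, 1₃) (⊖⊕ m p₂)
  gf (m , 2₃) = cong (_, 2₃) (⊖⊕ m p₀)

{-# OPTIONS --safe #-}
module Submission where

-- a = σ₀σ₁ and b = σ₁σ₀ translate the three sheets of E by (−p₁, −p₂, −p₀) and (−p₂, −p₀, −p₁),
-- and conjugation by σ₀ rotates the sheets: σ₀ b σ₀⁻¹ = a and σ₀ a σ₀⁻¹ = (a b)⁻¹, the latter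
-- because p₀ + p₁ + p₂ ≡ 0 (mod n).  Since σ₀³ = 1, H = ⟨σ₀⟩ normalises N, so NH is a subgroup;
-- it contains σ₀ and σ₁ = b σ₀⁻¹, hence equals G.

open import Defs
open import Data.Nat using (ℕ; suc; _+_; _<_; NonZero)
open import Data.Nat.Properties using (+-assoc; +-comm)
open import Data.Nat.DivMod using (_%_; %-distribˡ-+; m%n%n≡m%n; [m+n]%n≡m%n; m<n⇒m%n≡m)
open import Data.Nat.GCD using (gcd)
open import Data.Fin using (Fin; toℕ)
import Data.Fin as Fin
open import Data.Fin.Properties using (toℕ-fromℕ<; toℕ-injective; toℕ<n)
open import Data.Product using (_×_; proj₁) renaming (_,_ to _,,_)
open import Relation.Binary.PropositionalEquality using (_≡_; refl; sym; trans; cong; module ≡-Reasoning)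
open ≡-Reasoning

m+n+o≡n+o+m : ∀ m n o → m + n + o ≡ n + o + m
m+n+o≡n+o+m m n o = trans (+-assoc m n o) (+-comm m (n + o))

[m%n+k]%n≡[m+k]%n : ∀ m k n .{{_ : NonZero n}} → (m % n + k) % n ≡ (m + k) % n
[m%n+k]%n≡[m+k]%n m k n = begin
  (m % n + k) % n          ≡⟨ %-distribˡ-+ (m % n) k n ⟩
  (m % n % n + k % n) % n  ≡⟨ cong (λ r → (r + k % n) % n) (m%n%n≡m%n m n) ⟩
  (m % n + k % n) % n      ≡⟨ %-distribˡ-+ m k n ⟨
  (m + k) % n              ∎

toℕ-⊕ : ∀ {n} (m : Fin (suc n)) a → toℕ (m ⊕ a) ≡ (toℕ m + a) % suc n
toℕ-⊕ m a = toℕ-fromℕ< _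

⊕-⊕ : ∀ {n} (m : Fin n) a b → (m ⊕ a) ⊕ b ≡ m ⊕ (a + b)
⊕-⊕ {suc n} m a b = toℕ-injective (begin
  toℕ ((m ⊕ a) ⊕ b)                  ≡⟨ toℕ-⊕ (m ⊕ a) b ⟩
  (toℕ (m ⊕ a) + b) % suc n          ≡⟨ cong (λ r → (r + b) % suc n) (toℕ-⊕ m a) ⟩
  ((toℕ m + a) % suc n + b) % suc n  ≡⟨ [m%n+k]%n≡[m+k]%n (toℕ m + a) b (suc n) ⟩
  (toℕ m + a + b) % suc n            ≡⟨ cong (_% suc n) (+-assoc (toℕ m) a b) ⟩
  (toℕ m + (a + b)) % suc n          ≡⟨ toℕ-⊕ m (a + b) ⟨
  toℕ (m ⊕ (a + b))                  ∎)

⊕-n : ∀ {n} (m : Fin n) → m ⊕ n ≡ m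
⊕-n {suc n} m = toℕ-injective (begin
  toℕ (m ⊕ suc n)          ≡⟨ toℕ-⊕ m (suc n) ⟩
  (toℕ m + suc n) % suc n  ≡⟨ [m+n]%n≡m%n (toℕ m) (suc n) ⟩
  toℕ m % suc n            ≡⟨ m<n⇒m%n≡m (toℕ<n m) ⟩
  toℕ m                    ∎)

⊕-⊕≡⊖ : ∀ {n} (m : Fin n) a b c → a + b + c ≡ n → (m ⊕ a) ⊕ b ≡ m ⊖ c
⊕-⊕≡⊖ {n} m a b c a+b+c≡n = begin
  (m ⊕ a) ⊕ b              ≡⟨ ⊕⊖ ((m ⊕ a) ⊕ b) c ⟨
  (((m ⊕ a) ⊕ b) ⊕ c) ⊖ c  ≡⟨ cong (λ r → (r ⊕ c) ⊖ c) (⊕-⊕ m a b) ⟩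
  ((m ⊕ (a + b)) ⊕ c) ⊖ c  ≡⟨ cong (_⊖ c) (trans (⊕-⊕ m (a + b) c) (cong (m ⊕_) a+b+c≡n)) ⟩
  (m ⊕ n) ⊖ c              ≡⟨ cong (_⊖ c) (⊕-n m) ⟩
  m ⊖ c                    ∎

module _ {n : ℕ} where

  record IsSubgroup (P : Perm n → Set) : Set where
    field
      idP-∈ : P idP
      ⁻¹-∈  : ∀ {σ} → P σ → P (σ ⁻¹ₚ)
      ∘-∈   : ∀ {σ τ} → P σ → P τ → P (σ ∘ₚ τ)
      ≈-∈   : ∀ {σ τ} → σ ≈ τ → P σ → P τ

  ⟨⟩-isSubgroup : ∀ {I} {g : I → Perm n} → IsSubgroup ⟨ g ⟩
  ⟨⟩-isSubgroup = record { idP-∈ = one ; ⁻¹-∈ = inv ; ∘-∈ = mul ; ≈-∈ = ext }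

  ⟨⟩-least : ∀ {I} {g : I → Perm n} {P : Perm n → Set} →
             IsSubgroup P → (∀ i → P (g i)) → ∀ {σ} → ⟨ g ⟩ σ → P σ
  ⟨⟩-least P-sub g∈P (gen i)     = g∈P i
  ⟨⟩-least P-sub g∈P one         = IsSubgroup.idP-∈ P-sub
  ⟨⟩-least P-sub g∈P (inv σ∈)    = IsSubgroup.⁻¹-∈ P-sub (⟨⟩-least P-sub g∈P σ∈)
  ⟨⟩-least P-sub g∈P (mul σ∈ τ∈) = IsSubgroup.∘-∈ P-sub (⟨⟩-least P-sub g∈P σ∈) (⟨⟩-least P-sub g∈P τ∈)
  ⟨⟩-least P-sub g∈P (ext eq σ∈) = IsSubgroup.≈-∈ P-sub eq (⟨⟩-least P-sub g∈P σ∈)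

  ⁻¹-cong : {σ τ : Perm n} → σ ≈ τ → (σ ⁻¹ₚ) ≈ (τ ⁻¹ₚ)
  ⁻¹-cong {σ} {τ} σ≈τ x = begin
    from σ x                    ≡⟨ cong (from σ) (to-from τ x) ⟨
    from σ (to τ (from τ x))    ≡⟨ cong (from σ) (σ≈τ (from τ x)) ⟨
    from σ (to σ (from τ x))    ≡⟨ from-to σ (from τ x) ⟩
    from τ x                    ∎

  conj : Perm n → Perm n → Perm n
  conj h σ = h ∘ₚ (σ ∘ₚ (h ⁻¹ₚ))

  conj-cong : ∀ {h h′} (σ : Perm n) → h ≈ h′ → conj h σ ≈ conj h′ σ
  conj-cong {h} {h′} σ h≈h′ x = trans (cong (λ y → to h (to σ y)) (⁻¹-cong {h} {h′} h≈h′ x)) (h≈h′ _)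

  Normalises : (Perm n → Set) → Perm n → Set
  Normalises N h = ∀ {σ} → N σ → N (conj h σ)

  module _ {N : Perm n → Set} (N-sub : IsSubgroup N) where
    open IsSubgroup N-sub

    conj-preimage-isSubgroup : ∀ h → IsSubgroup (λ σ → N (conj h σ))
    conj-preimage-isSubgroup h = record
      { idP-∈ = ≈-∈ (λ x → sym (to-from h x)) idP-∈
      ; ⁻¹-∈  = λ σ∈ → ≈-∈ (λ _ → refl) (⁻¹-∈ σ∈)
      ; ∘-∈   = λ {σ} {τ} σ∈ τ∈ →
                  ≈-∈ (λ x → cong (λ y → to h (to σ y)) (from-to h (to τ (from h x)))) (∘-∈ σ∈ τ∈)
      ; ≈-∈   = λ σ≈τ σ∈ → ≈-∈ (λ x → cong (to h) (σ≈τ (from h x))) σ∈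
      }

    Normalises-idP : Normalises N idP
    Normalises-idP σ∈ = ≈-∈ (λ _ → refl) σ∈

    Normalises-∘ : ∀ {h h′} → Normalises N h → Normalises N h′ → Normalises N (h ∘ₚ h′)
    Normalises-∘ h-nor h′-nor σ∈ = ≈-∈ (λ _ → refl) (h-nor (h′-nor σ∈))

    Normalises-≈ : ∀ {h h′} → h ≈ h′ → Normalises N h → Normalises N h′
    Normalises-≈ {h} {h′} h≈h′ h-nor {σ} σ∈ = ≈-∈ (conj-cong {h} {h′} σ h≈h′) (h-nor σ∈)

    normaliser : Perm n → Set
    normaliser h = Normalises N h × Normalises N (h ⁻¹ₚ)

    normaliser-isSubgroup : IsSubgroup normaliser
    normaliser-isSubgroup = record
      { idP-∈ = Normalises-idP ,, Normalises-idP
      ; ⁻¹-∈  = λ (h-nor ,, h⁻¹-nor) → h⁻¹-nor ,, h-nor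
      ; ∘-∈   = λ {h} {h′} (h-nor ,, h⁻¹-nor) (h′-nor ,, h′⁻¹-nor) →
                  Normalises-∘ {h} {h′} h-nor h′-nor ,,
                  Normalises-≈ {(h′ ⁻¹ₚ) ∘ₚ (h ⁻¹ₚ)} {(h ∘ₚ h′) ⁻¹ₚ} (λ _ → refl)
                    (Normalises-∘ {h′ ⁻¹ₚ} {h ⁻¹ₚ} h′⁻¹-nor h⁻¹-nor)
      ; ≈-∈   = λ {h} {h′} h≈h′ (h-nor ,, h⁻¹-nor) →
                  Normalises-≈ {h} {h′} h≈h′ h-nor ,,
                  Normalises-≈ {h ⁻¹ₚ} {h′ ⁻¹ₚ} (⁻¹-cong {h} {h′} h≈h′) h⁻¹-nor
      }

  ⟨⟩-normalised : ∀ {I} {g : I → Perm n} {h} → (∀ i → ⟨ g ⟩ (conj h (g i))) → Normalises ⟨ g ⟩ h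
  ⟨⟩-normalised {h = h} = ⟨⟩-least (conj-preimage-isSubgroup ⟨⟩-isSubgroup h)

  module _ {N H : Perm n → Set} (N-sub : IsSubgroup N) (H-sub : IsSubgroup H)
           (H-normalises : ∀ {h} → H h → Normalises N h) where
    private
      module N = IsSubgroup N-sub
      module H = IsSubgroup H-sub

    -- (x y)⁻¹ = (y⁻¹ x⁻¹ y) y⁻¹  and  (x y)(x′ y′) = (x (y x′ y⁻¹)) (y y′).
    ·-isSubgroup : IsSubgroup (N · H)
    ·-isSubgroup = record
      { idP-∈ = idP ,, idP ,, N.idP-∈ ,, H.idP-∈ ,, (λ _ → refl)
      ; ⁻¹-∈  = λ { {σ} (x ,, y ,, x∈ ,, y∈ ,, xy≈σ) →
                  conj (y ⁻¹ₚ) (x ⁻¹ₚ) ,, y ⁻¹ₚ ,, H-normalises (H.⁻¹-∈ y∈) (N.⁻¹-∈ x∈) ,, H.⁻¹-∈ y∈ ,,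
                  λ z → trans (cong (λ w → from y (from x w)) (to-from y z)) (⁻¹-cong {x ∘ₚ y} {σ} xy≈σ z) }
      ; ∘-∈   = λ { {σ} {τ} (x ,, y ,, x∈ ,, y∈ ,, xy≈σ) (x′ ,, y′ ,, x′∈ ,, y′∈ ,, x′y′≈τ) →
                  x ∘ₚ conj y x′ ,, y ∘ₚ y′ ,, N.∘-∈ x∈ (H-normalises y∈ x′∈) ,, H.∘-∈ y∈ y′∈ ,,
                  λ z → trans (cong (λ w → to x (to y (to x′ w))) (from-to y (to y′ z)))
                              (trans (cong (λ w → to x (to y w)) (x′y′≈τ z)) (xy≈σ (to τ z))) }
      ; ≈-∈   = λ { σ≈τ (x ,, y ,, x∈ ,, y∈ ,, xy≈σ) → x ,, y ,, x∈ ,, y∈ ,, λ z → trans (xy≈σ z) (σ≈τ z) }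
      }

  ·≐⟨⟩ : ∀ {I} {g : I → Perm n} {N H : Perm n → Set} →
         IsSubgroup N → IsSubgroup H → (∀ {h} → H h → Normalises N h) →
         (∀ {σ} → N σ → ⟨ g ⟩ σ) → (∀ {σ} → H σ → ⟨ g ⟩ σ) → (∀ i → (N · H) (g i)) →
         (N · H) ≐ ⟨ g ⟩
  ·≐⟨⟩ N-sub H-sub H-normalises N⊆G H⊆G g∈NH =
      (λ { σ (x ,, y ,, x∈ ,, y∈ ,, xy≈σ) → ext xy≈σ (mul (N⊆G x∈) (H⊆G y∈)) })
   ,, (λ σ → ⟨⟩-least (·-isSubgroup N-sub H-sub H-normalises) g∈NH)

σ₀⁻¹≈σ₀∘σ₀ : ∀ {n} → (σ₀ {n} ⁻¹ₚ) ≈ (σ₀ ∘ₚ σ₀)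
σ₀⁻¹≈σ₀∘σ₀ (m ,, 0₃) = refl
σ₀⁻¹≈σ₀∘σ₀ (m ,, 1₃) = refl
σ₀⁻¹≈σ₀∘σ₀ (m ,, 2₃) = refl

module _ (p₀ p₁ p₂ : ℕ) where
  private
    n = p₀ + p₁ + p₂
    s₀ = σ₀ {n}
    s₁ = σ₁ {n} p₀ p₁ p₂
    a = s₀ ∘ₚ s₁
    b = s₁ ∘ₚ s₀
    G = ⟨ [ s₀ , s₁ ] ⟩
    N = ⟨ [ a , b ] ⟩
    H = ⟨ [ s₀ ] ⟩

  conj-σ₀-σ₀σ₁ : conj s₀ a ≈ ((b ⁻¹ₚ) ∘ₚ (a ⁻¹ₚ))
  conj-σ₀-σ₀σ₁ (m ,, 0₃) = cong (_,, 0₃) (sym (⊕-⊕≡⊖ m p₁ p₂ p₀ (sym (m+n+o≡n+o+m p₀ p₁ p₂))))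
  conj-σ₀-σ₀σ₁ (m ,, 1₃) = cong (_,, 1₃) (sym (⊕-⊕≡⊖ m p₂ p₀ p₁ (m+n+o≡n+o+m p₂ p₀ p₁)))
  conj-σ₀-σ₀σ₁ (m ,, 2₃) = cong (_,, 2₃) (sym (⊕-⊕≡⊖ m p₀ p₁ p₂ refl))

  conj-σ₀-σ₁σ₀ : conj s₀ b ≈ a
  conj-σ₀-σ₁σ₀ x = cong (λ y → to s₀ (to s₁ y)) (to-from s₀ x)

  σ₁≈σ₁σ₀∘σ₀⁻¹ : s₁ ≈ (b ∘ₚ (s₀ ⁻¹ₚ))
  σ₁≈σ₁σ₀∘σ₀⁻¹ x = cong (to s₁) (sym (to-from s₀ x))

  σ₀-normalises-N : Normalises N s₀
  σ₀-normalises-N = ⟨⟩-normalised {h = s₀} λ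
    { Fin.zero    → ext (λ x → sym (conj-σ₀-σ₀σ₁ x)) (mul (inv (gen (Fin.suc Fin.zero))) (inv (gen Fin.zero)))
    ; (Fin.suc _) → ext (λ x → sym (conj-σ₀-σ₁σ₀ x)) (gen Fin.zero)
    }

  σ₀⁻¹-normalises-N : Normalises N (s₀ ⁻¹ₚ)
  σ₀⁻¹-normalises-N = Normalises-≈ ⟨⟩-isSubgroup {s₀ ∘ₚ s₀} {s₀ ⁻¹ₚ} (λ x → sym (σ₀⁻¹≈σ₀∘σ₀ x))
                        (Normalises-∘ ⟨⟩-isSubgroup {s₀} {s₀} σ₀-normalises-N σ₀-normalises-N)

  H-normalises-N : ∀ {h} → H h → Normalises N h
  H-normalises-N h∈H =
    proj₁ (⟨⟩-least (normaliser-isSubgroup ⟨⟩-isSubgroup) (λ _ → σ₀-normalises-N ,, σ₀⁻¹-normalises-N) h∈H)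

  N⊆G : ∀ {σ} → N σ → G σ
  N⊆G = ⟨⟩-least ⟨⟩-isSubgroup λ
    { Fin.zero    → mul (gen Fin.zero) (gen (Fin.suc Fin.zero))
    ; (Fin.suc _) → mul (gen (Fin.suc Fin.zero)) (gen Fin.zero)
    }

  H⊆G : ∀ {σ} → H σ → G σ
  H⊆G = ⟨⟩-least ⟨⟩-isSubgroup λ _ → gen Fin.zero

  σ₀,σ₁∈NH : ∀ i → (N · H) ([ s₀ , s₁ ] i)
  σ₀,σ₁∈NH Fin.zero    = idP ,, s₀ ,, one ,, gen Fin.zero ,, λ _ → refl
  σ₀,σ₁∈NH (Fin.suc _) = b ,, s₀ ⁻¹ₚ ,, gen (Fin.suc Fin.zero) ,, inv (gen Fin.zero) ,,
                         λ x → sym (σ₁≈σ₁σ₀∘σ₀⁻¹ x)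

lemma6 : (p₀ p₁ p₂ : ℕ) → 0 < p₀ → 0 < p₁ → 0 < p₂ →
    gcd (gcd p₀ p₁) p₂ ≡ 1 →
    let n = p₀ + p₁ + p₂
        s₀ = σ₀ {n}
        s₁ = σ₁ {n} p₀ p₁ p₂
        G = ⟨ [ s₀ , s₁ ] ⟩
        N = ⟨ [ s₀ ∘ₚ s₁ , s₁ ∘ₚ s₀ ] ⟩
        H = ⟨ [ s₀ ] ⟩
    in (N · H) ≐ G
lemma6 p₀ p₁ p₂ _ _ _ _ =
  ·≐⟨⟩ ⟨⟩-isSubgroup ⟨⟩-isSubgroup (H-normalises-N p₀ p₁ p₂)
       (N⊆G p₀ p₁ p₂) (H⊆G p₀ p₁ p₂) (σ₀,σ₁∈NH p₀ p₁ p₂)
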